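{- A graph $G$ is a $2$-cograph if and only if it can be generated from $K_1$ using the operations of complementation, $0$-sum and $1$-sum.
   Context: All graphs are finite and simple; $\overline{G}$ denotes the complement of $G$. A graph is $2$-connected if it has at least three vertices, is connected, and has no cut vertex. A graph $G$ is a $2$-cograph if $G$ has no induced subgraph $H$ such that both $H$ and $\overline{H}$ are $2$-connected. Complementation replaces a graph by its complement. For graphs $G_1,G_2$ with disjoint vertex sets, the $0$-sum is their disjoint union, and a $1$-sum is a graph obtained from their disjoint union by identifying a vertex of $G_1$ with a vertex of $G_2$. -}

module Defs where

open import Data.Nat using (ℕ; zero; suc; _+_; _≤_)
open import Data.Fin using (Fin; splitAt; punchIn; _≟_)
open import Data.Fin.Permutation using (Permutation′; _⟨$⟩ʳ_)
open import Data.Bool using (Bool; true; false; not; _∧_)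
open import Data.Sum using (_⊎_; inj₁; inj₂)
open import Data.Product using (_×_; Σ; ∃)
open import Data.Empty using (⊥)
open import Relation.Nullary using (¬_; yes; no)
open import Relation.Binary.PropositionalEquality using (_≡_)
open import Function.Definitions using (Injective)

Adj : ℕ → Set
Adj n = Fin n → Fin n → Bool

IsSimple : ∀ {n} → Adj n → Set
IsSimple {n} A = (∀ (i j : Fin n) → A i j ≡ A j i) × (∀ (i : Fin n) → A i i ≡ false)

compl : ∀ {n} → Adj n → Adj n
compl A i j with i ≟ j
... | yes _ = false
... | no  _ = not (A i j)

induce : ∀ {k n} → Adj n → (Fin k → Fin n) → Adj k
induce A e i j = A (e i) (e j)

delete : ∀ {n} → Adj (suc n) → Fin (suc n) → Adj n
delete A v i j = A (punchIn v i) (punchIn v j)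

data Walk {n} (A : Adj n) : Fin n → Fin n → Set where
  here : ∀ {i} → Walk A i i
  step : ∀ {i j k} → A i j ≡ true → Walk A j k → Walk A i k

Connected : ∀ {n} → Adj n → Set
Connected {n} A = ∀ (i j : Fin n) → Walk A i j

-- 2-connected: at least three vertices, connected, no cut vertex
-- (for a connected graph, v is a cut vertex iff G - v is disconnected)
TwoConnected : ∀ {n} → Adj n → Set
TwoConnected {zero}  A = ⊥
TwoConnected {suc m} A = 3 ≤ suc m × Connected A × (∀ v → Connected (delete A v))

TwoCograph : ∀ {n} → Adj n → Set
TwoCograph {n} A =
  ∀ (k : ℕ) (e : Fin k → Fin n) → Injective _≡_ _≡_ e →
    ¬ (TwoConnected (induce A e) × TwoConnected (compl (induce A e)))

K1 : Adj 1
K1 _ _ = false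

sum0 : ∀ {m n} → Adj m → Adj n → Adj (m + n)
sum0 {m} A B x y with splitAt m x | splitAt m y
... | inj₁ a | inj₁ b = A a b
... | inj₂ a | inj₂ b = B a b
... | _      | _      = false

-- 1-sum: identify vertex u of G1 with vertex v of G2.  The first suc m
-- vertices are those of G1 (u playing the role of the identified vertex),
-- the last n are the vertices of G2 other than v (via punchIn v).
sum1 : ∀ {m n} → Adj (suc m) → Adj (suc n) → Fin (suc m) → Fin (suc n) → Adj (suc m + n)
sum1 {m} A B u v x y with splitAt (suc m) x | splitAt (suc m) y
... | inj₁ a | inj₁ b = A a b
... | inj₂ a | inj₂ b = B (punchIn v a) (punchIn v b)
... | inj₁ a | inj₂ b with a ≟ u
...   | yes _ = B v (punchIn v b)
...   | no  _ = false
sum1 {m} A B u v x y | inj₂ a | inj₁ b with b ≟ u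
...   | yes _ = B (punchIn v a) v
...   | no  _ = false

data Generated : (n : ℕ) → Adj n → Set where
  gen-K1    : Generated 1 K1
  gen-compl : ∀ {n A} → Generated n A → Generated n (compl A)
  gen-sum0  : ∀ {m n A B} → Generated m A → Generated n B → Generated (m + n) (sum0 A B)
  gen-sum1  : ∀ {m n A B} → Generated (suc m) A → Generated (suc n) B →
              (u : Fin (suc m)) (v : Fin (suc n)) → Generated (suc m + n) (sum1 A B u v)

Iso : ∀ {n} → Adj n → Adj n → Set
Iso {n} A B = Σ (Permutation′ n) λ σ → ∀ (i j : Fin n) → A i j ≡ B (σ ⟨$⟩ʳ i) (σ ⟨$⟩ʳ j)

CanBeGenerated : ∀ {n} → Adj n → Set
CanBeGenerated {n} A = ∃ λ B → Generated n B × Iso A B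

-- Generated graphs are 2-cographs because 2-cographs are closed under the three
-- operations and under isomorphism.  Complementation only swaps the roles of an
-- induced H and its complement.  A connected induced subgraph of a 0-sum lies in one
-- summand.  In a 1-sum, away from the identified vertex no edge joins the two
-- summands; a 2-connected induced subgraph stays connected after removing that vertex
-- (if it contains it), so it too lies in one summand.
--
-- Conversely, argue by induction on the number of vertices.  On at least three
-- vertices G and its complement are not both 2-connected, so (after complementing if
-- necessary) G is disconnected or has a cut vertex v.  Splitting the vertices along a
-- closed set of G, or of G - v, exhibits G up to relabelling as a 0-sum of two proper
-- induced subgraphs, or as a 1-sum at v of two proper induced subgraphs containing v.
-- These are 2-cographs with fewer vertices, hence generated.

module Submission where

open import Data.Bool using (Bool; true; false; not)
open import Data.Bool.Properties using (not-involutive) renaming (_≟_ to _≟ᵇ_)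
open import Data.Fin using (Fin; zero; suc; splitAt; join; punchIn; punchOut; _≟_)
open import Data.Fin.Permutation
  using (Permutation; _⟨$⟩ʳ_; _⟨$⟩ˡ_; inverseʳ; flip; _∘ₚ_; remove; insert; punchIn-permute; ↔⇒≡)
  renaming (id to idₚ)
open import Data.Fin.Properties
  using (punchIn-injective; punchInᵢ≢i; punchIn-punchOut; splitAt-join; +↔⊎; any?; all?; ¬∀⟶∃¬)
open import Data.Fin.Subset using (Subset; _∈_; _∉_; _∪_; ⁅_⁆; _⊃_)
open import Data.Fin.Subset.Induction using (⊃-wellFounded)
open import Data.Fin.Subset.Properties using (_∈?_; x∈⁅x⁆; x∈⁅y⁆⇒x≡y; p⊆p∪q; q⊆p∪q; x∈p∪q⁻)
open import Data.Nat using (ℕ; zero; suc; _+_; _≤_; _<_; s≤s; z≤n)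
open import Data.Nat.Induction using (<-rec)
open import Data.Nat.Properties using (m<m+n; m<n+m; ≤-pred)
open import Data.Product using (_×_; _,_; ∃; proj₁; proj₂)
open import Data.Sum using (_⊎_; inj₁; inj₂; [_,_]′; map)
open import Data.Sum.Algebra using (⊎-cong; ⊎-comm; ⊎-assoc)
open import Data.Sum.Properties using (inj₁-injective; inj₂-injective; ≡-dec)
open import Function using (_∘_; const; id)
open import Function.Bundles using (Inverse; Injection; _↔_; _⇔_; mk⇔)
open import Function.Construct.Composition using (_↔-∘_)
open import Function.Construct.Identity using (↔-id)
open import Function.Construct.Symmetry using (↔-sym)
open import Function.Definitions using (Injective)
open import Function.Properties.Inverse using (↔⇒↣)
open import Induction.WellFounded using (Acc; acc)
open import Level using (0ℓ)
open import Relation.Binary.PropositionalEquality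
open import Relation.Nullary using (¬_; Dec; yes; no; contradiction)
open import Relation.Nullary.Decidable using (_×-dec_; ¬?; decidable-stable)
open import Relation.Unary using (Decidable)

open import Defs

open ≡-Reasoning

private
  variable
    k m m′ n n′ p : ℕ

↔-injective : {X Y : Set} (π : X ↔ Y) → Injective _≡_ _≡_ (Inverse.to π)
↔-injective π = Injection.injective (↔⇒↣ π)

splitAt-injective : ∀ m {n} {x y : Fin (m + n)} → splitAt m x ≡ splitAt m y → x ≡ y
splitAt-injective m = ↔-injective (+↔⊎ {m})

punchIn-cover : ∀ {P : Fin (suc n) → Set} w → P w → (∀ j → P (punchIn w j)) → ∀ i → P i
punchIn-cover {P = P} w pw pj i with w ≟ i
... | yes refl = pw
... | no w≢i   = subst P (punchIn-punchOut w≢i) (pj (punchOut w≢i))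

extend : Fin (suc n) → (Fin k → Fin n) → Fin (suc k) → Fin (suc n)
extend v f zero    = v
extend v f (suc a) = punchIn v (f a)

extend-injective : ∀ v {f : Fin k → Fin n} → Injective _≡_ _≡_ f → Injective _≡_ _≡_ (extend v f)
extend-injective v f-inj {zero}  {zero}  _  = refl
extend-injective v f-inj {zero}  {suc b} eq = contradiction (sym eq) (punchInᵢ≢i v _)
extend-injective v f-inj {suc a} {zero}  eq = contradiction eq (punchInᵢ≢i v _)
extend-injective v f-inj {suc a} {suc b} eq = cong suc (f-inj (punchIn-injective v _ _ eq))

all-or-exception : ∀ {P Q : Fin n → Set} → (∀ i → P i ⊎ Q i) → (∀ i → P i) ⊎ ∃ Q
all-or-exception {zero}  pq = inj₁ λ ()
all-or-exception {suc n} pq with pq zero | all-or-exception (pq ∘ suc)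
... | inj₂ q | _            = inj₂ (zero , q)
... | inj₁ _ | inj₂ (i , q) = inj₂ (suc i , q)
... | inj₁ p | inj₁ ps      = inj₁ λ { zero → p ; (suc i) → ps i }

IsInj₁ : {X Y : Set} → X ⊎ Y → Set
IsInj₁ {X} s = ∃ λ (x : X) → s ≡ inj₁ x

IsInj₂ : {X Y : Set} → X ⊎ Y → Set
IsInj₂ {Y = Y} s = ∃ λ (y : Y) → s ≡ inj₂ y

inj₁-or-inj₂ : {X Y : Set} (s : X ⊎ Y) → IsInj₁ s ⊎ IsInj₂ s
inj₁-or-inj₂ (inj₁ x) = inj₁ (x , refl)
inj₁-or-inj₂ (inj₂ y) = inj₂ (y , refl)

inj₁-witness-injective : {X Y : Set} {f : Fin k → X ⊎ Y} → Injective _≡_ _≡_ f →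
  (w : ∀ i → IsInj₁ (f i)) → Injective _≡_ _≡_ (proj₁ ∘ w)
inj₁-witness-injective f-inj w {i} {j} eq =
  f-inj (trans (proj₂ (w i)) (trans (cong inj₁ eq) (sym (proj₂ (w j)))))

inj₂-witness-injective : {X Y : Set} {f : Fin k → X ⊎ Y} → Injective _≡_ _≡_ f →
  (w : ∀ i → IsInj₂ (f i)) → Injective _≡_ _≡_ (proj₁ ∘ w)
inj₂-witness-injective f-inj w {i} {j} eq =
  f-inj (trans (proj₂ (w i)) (trans (cong inj₂ eq) (sym (proj₂ (w j)))))

-- Walks and closed vertex sets

Symmetric : Adj n → Set
Symmetric {n} A = ∀ (i j : Fin n) → A i j ≡ A j i

_▷_ : ∀ {A : Adj n} {i j l} → Walk A i j → A j l ≡ true → Walk A i l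
here     ▷ e = step e here
step x w ▷ e = step x (w ▷ e)

_++ʷ_ : ∀ {A : Adj n} {i j l} → Walk A i j → Walk A j l → Walk A i l
here     ++ʷ w = w
step x v ++ʷ w = step x (v ++ʷ w)

reverseʷ : ∀ {A : Adj n} → Symmetric A → ∀ {i j} → Walk A i j → Walk A j i
reverseʷ sym-A here               = here
reverseʷ sym-A (step {i} {j} x w) = reverseʷ sym-A w ▷ trans (sym-A j i) x

Closed : Adj n → (Fin n → Set) → Set
Closed {n} A P = ∀ (x y : Fin n) → P x → A x y ≡ true → P y

induce-closed : ∀ {A : Adj n} {P} (f : Fin k → Fin n) → Closed A P → Closed (induce A f) (P ∘ f)
induce-closed f c x y = c (f x) (f y)

walk-closed : ∀ {A : Adj n} {P} → Closed A P → ∀ {i j} → Walk A i j → P i → P j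
walk-closed c here       px = px
walk-closed c (step x w) px = walk-closed c w (c _ _ px x)

no-edge-leaving : ∀ {A : Adj n} {P x y} → Closed A P → P x → ¬ P y → A x y ≡ false
no-edge-leaving {A = A} {x = x} {y} c px ¬py with A x y in e
... | false = refl
... | true  = contradiction (c x y px e) ¬py

connected-dichotomy : ∀ {A : Adj n} {P Q : Fin n → Set} → Connected A → Closed A P → Closed A Q →
  (∀ i → P i ⊎ Q i) → Fin n → (∀ i → P i) ⊎ (∀ i → Q i)
connected-dichotomy conn cP cQ pq i₀ with pq i₀
... | inj₁ p = inj₁ λ j → walk-closed cP (conn i₀ j) p
... | inj₂ q = inj₂ λ j → walk-closed cQ (conn i₀ j) q

-- Loops are invisible to walks, so (2-)connectivity only depends on the entries off the diagonal.
SameEdges : Adj n → Adj n → Set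
SameEdges {n} A B = ∀ (i j : Fin n) → i ≢ j → A i j ≡ B i j

walk-sameEdges : ∀ {A B : Adj n} → SameEdges A B → ∀ {i j} → Walk A i j → Walk B i j
walk-sameEdges s here = here
walk-sameEdges s (step {i} {j} x w) with i ≟ j
... | yes refl = walk-sameEdges s w
... | no i≢j   = step (trans (sym (s i j i≢j)) x) (walk-sameEdges s w)

connected-sameEdges : ∀ {A B : Adj n} → SameEdges A B → Connected A → Connected B
connected-sameEdges s conn i j = walk-sameEdges s (conn i j)

delete-sameEdges : ∀ {A B : Adj (suc n)} → SameEdges A B → ∀ v → SameEdges (delete A v) (delete B v)
delete-sameEdges s v i j i≢j = s _ _ (i≢j ∘ punchIn-injective v i j)

twoConnected-sameEdges : ∀ {A B : Adj n} → SameEdges A B → TwoConnected A → TwoConnected B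
twoConnected-sameEdges {zero}  s ()
twoConnected-sameEdges {suc n} s (size , conn , conn-del) =
  size , connected-sameEdges s conn , λ v → connected-sameEdges (delete-sameEdges s v) (conn-del v)

compl-sameEdges : ∀ {A B : Adj n} → SameEdges A B → SameEdges (compl A) (compl B)
compl-sameEdges s i j i≢j with i ≟ j
... | yes i≡j = contradiction i≡j i≢j
... | no _    = cong not (s i j i≢j)

compl-involutiveᵒ : (A : Adj n) → SameEdges (compl (compl A)) A
compl-involutiveᵒ A i j i≢j with i ≟ j
... | yes i≡j = contradiction i≡j i≢j
... | no _ with i ≟ j
...   | yes i≡j = contradiction i≡j i≢j
...   | no _    = not-involutive (A i j)

induce-complᵒ : (A : Adj n) {e : Fin k → Fin n} → Injective _≡_ _≡_ e →
  SameEdges (induce (compl A) e) (compl (induce A e))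
induce-complᵒ A {e} e-inj i j i≢j with e i ≟ e j | i ≟ j
... | _        | yes i≡j = contradiction i≡j i≢j
... | yes ei≡ej | no _   = contradiction (e-inj ei≡ej) i≢j
... | no _     | no _    = refl

compl-irreflexive : (A : Adj n) → ∀ i → compl A i i ≡ false
compl-irreflexive A i with i ≟ i
... | yes _   = refl
... | no i≢i = contradiction refl i≢i

isSimple-induce : ∀ {A : Adj n} → IsSimple A → (f : Fin k → Fin n) → IsSimple (induce A f)
isSimple-induce (sym-A , irr-A) f = (λ i j → sym-A (f i) (f j)) , (λ i → irr-A (f i))

isSimple-compl : ∀ {A : Adj n} → IsSimple A → IsSimple (compl A)
isSimple-compl {A = A} (sym-A , _) = sym-compl , compl-irreflexive A
  where
  sym-compl : Symmetric (compl A)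
  sym-compl i j with i ≟ j | j ≟ i
  ... | yes _   | yes _   = refl
  ... | yes i≡j | no j≢i = contradiction (sym i≡j) j≢i
  ... | no i≢j  | yes j≡i = contradiction (sym j≡i) i≢j
  ... | no _    | no _    = cong not (sym-A i j)

sum0⊎ : Adj m → Adj n → Fin m ⊎ Fin n → Fin m ⊎ Fin n → Bool
sum0⊎ A B (inj₁ a) (inj₁ b) = A a b
sum0⊎ A B (inj₂ a) (inj₂ b) = B a b
sum0⊎ A B _        _        = false

sum0-splitAt : (A : Adj m) (B : Adj n) (x y : Fin (m + n)) →
  sum0 A B x y ≡ sum0⊎ A B (splitAt m x) (splitAt m y)
sum0-splitAt {m} A B x y with splitAt m x | splitAt m y
... | inj₁ a | inj₁ b = refl
... | inj₁ a | inj₂ b = refl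
... | inj₂ a | inj₁ b = refl
... | inj₂ a | inj₂ b = refl

sum1⊎ : Adj (suc m) → Adj (suc n) → Fin (suc m) → Fin (suc n) →
  Fin (suc m) ⊎ Fin n → Fin (suc m) ⊎ Fin n → Bool
sum1⊎ A B u v (inj₁ a) (inj₁ b) = A a b
sum1⊎ A B u v (inj₂ a) (inj₂ b) = B (punchIn v a) (punchIn v b)
sum1⊎ A B u v (inj₁ a) (inj₂ b) with a ≟ u
... | yes _ = B v (punchIn v b)
... | no  _ = false
sum1⊎ A B u v (inj₂ a) (inj₁ b) with b ≟ u
... | yes _ = B (punchIn v a) v
... | no  _ = false

sum1-splitAt : (A : Adj (suc m)) (B : Adj (suc n)) (u : Fin (suc m)) (v : Fin (suc n)) (x y : Fin (suc m + n)) →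
  sum1 A B u v x y ≡ sum1⊎ A B u v (splitAt (suc m) x) (splitAt (suc m) y)
sum1-splitAt {m} A B u v x y with splitAt (suc m) x | splitAt (suc m) y
... | inj₁ a | inj₁ b = refl
... | inj₂ a | inj₂ b = refl
... | inj₁ a | inj₂ b with a ≟ u
...   | yes _ = refl
...   | no  _ = refl
sum1-splitAt {m} A B u v x y | inj₂ a | inj₁ b with b ≟ u
...   | yes _ = refl
...   | no  _ = refl

sum0-join : (A : Adj m) (B : Adj n) (s t : Fin m ⊎ Fin n) →
  sum0 A B (join m n s) (join m n t) ≡ sum0⊎ A B s t
sum0-join {m} {n} A B s t = trans (sum0-splitAt A B (join m n s) (join m n t))
  (cong₂ (sum0⊎ A B) (splitAt-join m n s) (splitAt-join m n t))

sum1-join : (A : Adj (suc m)) (B : Adj (suc n)) (u : Fin (suc m)) (v : Fin (suc n)) (s t : Fin (suc m) ⊎ Fin n) →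
  sum1 A B u v (join (suc m) n s) (join (suc m) n t) ≡ sum1⊎ A B u v s t
sum1-join {m} {n} A B u v s t =
  trans (sum1-splitAt A B u v (join (suc m) n s) (join (suc m) n t))
    (cong₂ (sum1⊎ A B u v) (splitAt-join (suc m) n s) (splitAt-join (suc m) n t))

-- Generated graphs are 2-cographs

twoCograph-embed : ∀ {A : Adj p} {H : Adj n} {g : Fin n → Fin p} → TwoCograph A → Injective _≡_ _≡_ g →
  SameEdges (induce A g) H → TwoCograph H
twoCograph-embed {A = A} {H} {g} tA g-inj s k e e-inj (t₁ , t₂) =
  tA k (g ∘ e) (e-inj ∘ g-inj) (twoConnected-sameEdges s′ t₁ , twoConnected-sameEdges (compl-sameEdges s′) t₂)
  where
  s′ : SameEdges (induce H e) (induce A (g ∘ e))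
  s′ i j i≢j = sym (s (e i) (e j) (i≢j ∘ e-inj))

not-both-twoConnected : ∀ {A : Adj n} → TwoCograph A → ¬ (TwoConnected A × TwoConnected (compl A))
not-both-twoConnected tA = tA _ id id

twoCograph-compl : ∀ {A : Adj n} → TwoCograph A → TwoCograph (compl A)
twoCograph-compl {A = A} tA k e e-inj (t₁ , t₂) =
  tA k e e-inj
    ( twoConnected-sameEdges (compl-involutiveᵒ (induce A e)) (twoConnected-sameEdges (compl-sameEdges s) t₂)
    , twoConnected-sameEdges s t₁ )
  where
  s = induce-complᵒ A e-inj

twoCograph-K1 : TwoCograph K1
twoCograph-K1 zero          e e-inj (() , _)
twoCograph-K1 (suc zero)    e e-inj ((s≤s () , _) , _)
twoCograph-K1 (suc (suc k)) e e-inj _ with e zero in e₀ | e (suc zero) in e₁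
... | zero | zero with () ← e-inj (trans e₀ (sym e₁))

module _ {A : Adj m} {B : Adj n} where

  sum0⊎-stays-inj₁ : ∀ s t → sum0⊎ A B s t ≡ true → IsInj₁ s → IsInj₁ t
  sum0⊎-stays-inj₁ (inj₁ a) (inj₁ b) _  _       = b , refl
  sum0⊎-stays-inj₁ (inj₁ a) (inj₂ b) () _
  sum0⊎-stays-inj₁ (inj₂ a) t        _  (_ , ())

  sum0⊎-stays-inj₂ : ∀ s t → sum0⊎ A B s t ≡ true → IsInj₂ s → IsInj₂ t
  sum0⊎-stays-inj₂ (inj₂ a) (inj₂ b) _  _       = b , refl
  sum0⊎-stays-inj₂ (inj₂ a) (inj₁ b) () _
  sum0⊎-stays-inj₂ (inj₁ a) t        _  (_ , ())

  sum0-closed-inj₁ : Closed (sum0 A B) (IsInj₁ ∘ splitAt m)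
  sum0-closed-inj₁ x y px edge = sum0⊎-stays-inj₁ _ _ (trans (sym (sum0-splitAt A B x y)) edge) px

  sum0-closed-inj₂ : Closed (sum0 A B) (IsInj₂ ∘ splitAt m)
  sum0-closed-inj₂ x y px edge = sum0⊎-stays-inj₂ _ _ (trans (sym (sum0-splitAt A B x y)) edge) px

  twoCograph-sum0 : TwoCograph A → TwoCograph B → TwoCograph (sum0 A B)
  twoCograph-sum0 tA tB zero    e e-inj (() , _)
  twoCograph-sum0 tA tB (suc k) e e-inj t@((_ , conn , _) , _)
    with connected-dichotomy conn (induce-closed e sum0-closed-inj₁) (induce-closed e sum0-closed-inj₂)
           (λ i → inj₁-or-inj₂ (splitAt m (e i))) zero
  ... | inj₁ left  = not-both-twoConnected
          (twoCograph-embed {A = A} tA (inj₁-witness-injective (e-inj ∘ splitAt-injective m) left) edges) t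
    where
    edges : SameEdges (induce A (proj₁ ∘ left)) (induce (sum0 A B) e)
    edges i j _ =
      sym (trans (sum0-splitAt A B (e i) (e j)) (cong₂ (sum0⊎ A B) (proj₂ (left i)) (proj₂ (left j))))
  ... | inj₂ right = not-both-twoConnected
          (twoCograph-embed {A = B} tB (inj₂-witness-injective (e-inj ∘ splitAt-injective m) right) edges) t
    where
    edges : SameEdges (induce B (proj₁ ∘ right)) (induce (sum0 A B) e)
    edges i j _ =
      sym (trans (sum0-splitAt A B (e i) (e j)) (cong₂ (sum0⊎ A B) (proj₂ (right i)) (proj₂ (right j))))

-- Seen through splitAt, a vertex of sum1 A B u v is the identified vertex inj₁ u, a vertex
-- inj₁ a (a ≢ u) of A only, or a vertex inj₂ b of B other than v, namely punchIn v b.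
module _ {m n : ℕ} {A : Adj (suc m)} {B : Adj (suc n)} (u : Fin (suc m)) (v : Fin (suc n)) where

  private
    side : Fin (suc m + n) → Fin (suc m) ⊎ Fin n
    side = splitAt (suc m)

  InnerA : Fin (suc m) ⊎ Fin n → Set
  InnerA s = ∃ λ a → a ≢ u × s ≡ inj₁ a

  InB : Fin (suc m) ⊎ Fin n → Set
  InB s = s ≡ inj₁ u ⊎ IsInj₂ s

  toB : Fin (suc m) ⊎ Fin n → Fin (suc n)
  toB = [ const v , punchIn v ]′

  hub-or-innerA-or-inj₂ : ∀ s → s ≡ inj₁ u ⊎ InnerA s ⊎ IsInj₂ s
  hub-or-innerA-or-inj₂ (inj₂ b) = inj₂ (inj₂ (b , refl))
  hub-or-innerA-or-inj₂ (inj₁ a) with a ≟ u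
  ... | yes refl = inj₁ refl
  ... | no a≢u   = inj₂ (inj₁ (a , a≢u , refl))

  sum1⊎-stays-innerA : ∀ s t → sum1⊎ A B u v s t ≡ true → t ≢ inj₁ u → InnerA s → InnerA t
  sum1⊎-stays-innerA (inj₁ a) (inj₁ b) _ t≢u _ = b , t≢u ∘ cong inj₁ , refl
  sum1⊎-stays-innerA (inj₁ a) (inj₂ b) edge _ (_ , a≢u , refl) with a ≟ u
  ... | yes a≡u = contradiction a≡u a≢u
  sum1⊎-stays-innerA (inj₁ a) (inj₂ b) () _ _ | no _

  sum1⊎-stays-inj₂ : ∀ s t → sum1⊎ A B u v s t ≡ true → t ≢ inj₁ u → IsInj₂ s → IsInj₂ t
  sum1⊎-stays-inj₂ (inj₂ a) (inj₂ b) _ _ _ = b , refl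
  sum1⊎-stays-inj₂ (inj₂ a) (inj₁ b) edge t≢u _ with b ≟ u
  ... | yes b≡u = contradiction (cong inj₁ b≡u) t≢u
  sum1⊎-stays-inj₂ (inj₂ a) (inj₁ b) () _ _ | no _

  sum1⊎-on-B : ∀ {s t} → InB s → InB t → s ≢ t → sum1⊎ A B u v s t ≡ B (toB s) (toB t)
  sum1⊎-on-B (inj₁ refl)       (inj₁ refl)       s≢t = contradiction refl s≢t
  sum1⊎-on-B (inj₁ refl)       (inj₂ (b , refl)) _   with u ≟ u
  ... | yes _   = refl
  ... | no u≢u = contradiction refl u≢u
  sum1⊎-on-B (inj₂ (a , refl)) (inj₁ refl)       _   with u ≟ u
  ... | yes _   = refl
  ... | no u≢u = contradiction refl u≢u
  sum1⊎-on-B (inj₂ (a , refl)) (inj₂ (b , refl)) _   = refl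

  toB-injective : ∀ {s t} → InB s → InB t → toB s ≡ toB t → s ≡ t
  toB-injective (inj₁ refl)       (inj₁ refl)       _  = refl
  toB-injective (inj₁ refl)       (inj₂ (b , refl)) eq = contradiction (sym eq) (punchInᵢ≢i v b)
  toB-injective (inj₂ (a , refl)) (inj₁ refl)       eq = contradiction eq (punchInᵢ≢i v a)
  toB-injective (inj₂ (a , refl)) (inj₂ (b , refl)) eq = cong inj₂ (punchIn-injective v a b eq)

  sum1-connected-side : ∀ {f : Fin k → Fin (suc m + n)} → Connected (induce (sum1 A B u v) f) →
    (∀ i → side (f i) ≢ inj₁ u) → Fin k → (∀ i → InnerA (side (f i))) ⊎ (∀ i → IsInj₂ (side (f i)))
  sum1-connected-side {f = f} conn avoid =
    connected-dichotomy conn (closed sum1⊎-stays-innerA) (closed sum1⊎-stays-inj₂) classify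
    where
    edge⊎ : ∀ x y → sum1 A B u v (f x) (f y) ≡ true → sum1⊎ A B u v (side (f x)) (side (f y)) ≡ true
    edge⊎ x y edge = trans (sym (sum1-splitAt A B u v (f x) (f y))) edge
    closed : ∀ {P} → (∀ s t → sum1⊎ A B u v s t ≡ true → t ≢ inj₁ u → P s → P t) →
      Closed (induce (sum1 A B u v) f) (P ∘ side ∘ f)
    closed stays x y px edge = stays _ _ (edge⊎ x y edge) (avoid y) px
    classify : ∀ i → InnerA (side (f i)) ⊎ IsInj₂ (side (f i))
    classify i with hub-or-innerA-or-inj₂ (side (f i))
    ... | inj₁ hub = contradiction hub (avoid i)
    ... | inj₂ p   = p

  hub-only-at : ∀ {f : Fin (suc k) → Fin (suc m + n)} {w} → Injective _≡_ _≡_ f → side (f w) ≡ inj₁ u →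
    ∀ j → side (f (punchIn w j)) ≢ inj₁ u
  hub-only-at {w = w} f-inj hub j hub′ = punchInᵢ≢i w j (f-inj (splitAt-injective (suc m) (trans hub′ (sym hub))))

  -- Remove the identified vertex w if f hits it: what remains is still connected.
  sum1-twoConnected-side : ∀ {f : Fin k → Fin (suc m + n)} → Injective _≡_ _≡_ f →
    TwoConnected (induce (sum1 A B u v) f) → (∀ i → IsInj₁ (side (f i))) ⊎ (∀ i → InB (side (f i)))
  sum1-twoConnected-side {zero}        f-inj ()
  sum1-twoConnected-side {suc zero}    f-inj (s≤s () , _)
  sum1-twoConnected-side {suc (suc k)} {f} f-inj (_ , conn , conn-del)
    with any? (λ w → ≡-dec _≟_ _≟_ (side (f w)) (inj₁ u))
  ... | no no-hub with sum1-connected-side {f = f} conn (λ i hub → no-hub (i , hub)) zero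
  ...   | inj₁ innerA = inj₁ λ i → let (a , _ , eq) = innerA i in a , eq
  ...   | inj₂ outerB = inj₂ λ i → inj₂ (outerB i)
  sum1-twoConnected-side {suc (suc k)} {f} f-inj (_ , conn , conn-del)
      | yes (w , hub) with sum1-connected-side {f = f ∘ punchIn w} (conn-del w) (hub-only-at f-inj hub) zero
  ...   | inj₁ innerA = inj₁ (punchIn-cover w (u , hub) λ j → let (a , _ , eq) = innerA j in a , eq)
  ...   | inj₂ outerB = inj₂ (punchIn-cover w (inj₁ hub) λ j → inj₂ (outerB j))

  twoCograph-sum1 : TwoCograph A → TwoCograph B → TwoCograph (sum1 A B u v)
  twoCograph-sum1 tA tB k e e-inj t@(t₁ , _) with sum1-twoConnected-side e-inj t₁
  ... | inj₁ inA = not-both-twoConnected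
          (twoCograph-embed {A = A} tA (inj₁-witness-injective (e-inj ∘ splitAt-injective (suc m)) inA) edges) t
    where
    edges : SameEdges (induce A (proj₁ ∘ inA)) (induce (sum1 A B u v) e)
    edges i j _ =
      sym (trans (sum1-splitAt A B u v (e i) (e j)) (cong₂ (sum1⊎ A B u v) (proj₂ (inA i)) (proj₂ (inA j))))
  ... | inj₂ inB = not-both-twoConnected (twoCograph-embed {A = B} tB g-inj edges) t
    where
    g : Fin k → Fin (suc n)
    g i = toB (side (e i))
    g-inj : Injective _≡_ _≡_ g
    g-inj {i} {j} eq = e-inj (splitAt-injective (suc m) (toB-injective (inB i) (inB j) eq))
    edges : SameEdges (induce B g) (induce (sum1 A B u v) e)
    edges i j i≢j = sym (trans (sum1-splitAt A B u v (e i) (e j))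
      (sum1⊎-on-B (inB i) (inB j) (i≢j ∘ e-inj ∘ splitAt-injective (suc m))))

twoCograph-iso : ∀ {A B : Adj n} → Iso A B → TwoCograph B → TwoCograph A
twoCograph-iso {A = A} {B} (σ , e) tB = twoCograph-embed {A = B} {H = A} tB (↔-injective σ) λ i j _ → sym (e i j)

generated-twoCograph : ∀ {A : Adj n} → Generated n A → TwoCograph A
generated-twoCograph gen-K1              = twoCograph-K1
generated-twoCograph (gen-compl g)       = twoCograph-compl (generated-twoCograph g)
generated-twoCograph (gen-sum0 g h)      = twoCograph-sum0 (generated-twoCograph g) (generated-twoCograph h)
generated-twoCograph (gen-sum1 g h u v)  = twoCograph-sum1 u v (generated-twoCograph g) (generated-twoCograph h)

canBeGenerated-twoCograph : ∀ {A : Adj n} → CanBeGenerated A → TwoCograph A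
canBeGenerated-twoCograph (C , gen , iso) = twoCograph-iso {B = C} iso (generated-twoCograph gen)

-- Relabelling

Relabels : Adj m → Permutation m n → Adj n → Set
Relabels {m} A π B = ∀ (i j : Fin m) → A i j ≡ B (π ⟨$⟩ʳ i) (π ⟨$⟩ʳ j)

canBeGenerated-relabel : ∀ {A : Adj m} {B : Adj n} (π : Permutation m n) →
  Relabels A π B → CanBeGenerated A → CanBeGenerated B
canBeGenerated-relabel {A = A} {B} π r (C , gen , σ , e) with ↔⇒≡ π
... | refl = C , gen , flip π ∘ₚ σ , λ i j → begin
  B i j                                     ≡⟨ sym (cong₂ B (inverseʳ π) (inverseʳ π)) ⟩
  B (π ⟨$⟩ʳ (π ⟨$⟩ˡ i)) (π ⟨$⟩ʳ (π ⟨$⟩ˡ j)) ≡⟨ sym (r _ _) ⟩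
  A (π ⟨$⟩ˡ i) (π ⟨$⟩ˡ j)                   ≡⟨ e _ _ ⟩
  C (σ ⟨$⟩ʳ (π ⟨$⟩ˡ i)) (σ ⟨$⟩ʳ (π ⟨$⟩ˡ j)) ∎

relabels-compl : ∀ {A : Adj m} {B : Adj n} (π : Permutation m n) →
  Relabels A π B → Relabels (compl A) π (compl B)
relabels-compl π r i j with i ≟ j | π ⟨$⟩ʳ i ≟ π ⟨$⟩ʳ j
... | yes _   | yes _      = refl
... | yes i≡j | no πi≢πj   = contradiction (cong (π ⟨$⟩ʳ_) i≡j) πi≢πj
... | no i≢j  | yes πi≡πj = contradiction (↔-injective π πi≡πj) i≢j
... | no _    | no _       = cong not (r i j)

compl-involutive : ∀ {A : Adj n} → IsSimple A → Relabels (compl (compl A)) idₚ A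
compl-involutive {A = A} (_ , irr-A) i j = by-cases (i ≟ j)
  where
  by-cases : Dec (i ≡ j) → compl (compl A) i j ≡ A i j
  by-cases (yes refl) = trans (compl-irreflexive (compl A) i) (sym (irr-A i))
  by-cases (no i≢j)   = compl-involutiveᵒ A i j i≢j

_⊕_ : Permutation m m′ → Permutation n n′ → Permutation (m + n) (m′ + n′)
σ ⊕ τ = ↔-sym +↔⊎ ↔-∘ (⊎-cong σ τ ↔-∘ +↔⊎)

relabels-sum0 : ∀ {A : Adj m} {A′ : Adj m′} {B : Adj n} {B′ : Adj n′}
  (σ : Permutation m m′) (τ : Permutation n n′) →
  Relabels A σ A′ → Relabels B τ B′ → Relabels (sum0 A B) (σ ⊕ τ) (sum0 A′ B′)
relabels-sum0 {m} {A = A} {A′} {B} {B′} σ τ rA rB x y = begin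
  sum0 A B x y                                            ≡⟨ sum0-splitAt A B x y ⟩
  sum0⊎ A B (splitAt m x) (splitAt m y)                   ≡⟨ on⊎ (splitAt m x) (splitAt m y) ⟩
  sum0⊎ A′ B′ (map′ (splitAt m x)) (map′ (splitAt m y))
    ≡⟨ sym (sum0-join A′ B′ (map′ (splitAt m x)) (map′ (splitAt m y))) ⟩
  sum0 A′ B′ ((σ ⊕ τ) ⟨$⟩ʳ x) ((σ ⊕ τ) ⟨$⟩ʳ y)            ∎
  where
  map′ = map (σ ⟨$⟩ʳ_) (τ ⟨$⟩ʳ_)
  on⊎ : ∀ s t → sum0⊎ A B s t ≡ sum0⊎ A′ B′ (map′ s) (map′ t)
  on⊎ (inj₁ a) (inj₁ b) = rA a b
  on⊎ (inj₁ a) (inj₂ b) = refl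
  on⊎ (inj₂ a) (inj₁ b) = refl
  on⊎ (inj₂ a) (inj₂ b) = rB a b

relabels-sum1 : ∀ {A : Adj (suc m)} {A′ : Adj (suc m′)} {B : Adj (suc n)} {B′ : Adj (suc n′)}
  (σ : Permutation (suc m) (suc m′)) (τ : Permutation (suc n) (suc n′)) u v →
  Relabels A σ A′ → Relabels B τ B′ →
  Relabels (sum1 A B u v) (σ ⊕ remove v τ) (sum1 A′ B′ (σ ⟨$⟩ʳ u) (τ ⟨$⟩ʳ v))
relabels-sum1 {m} {A = A} {A′} {B} {B′} σ τ u v rA rB x y = begin
  sum1 A B u v x y                                       ≡⟨ sum1-splitAt A B u v x y ⟩
  sum1⊎ A B u v (splitAt (suc m) x) (splitAt (suc m) y)  ≡⟨ on⊎ (splitAt (suc m) x) (splitAt (suc m) y) ⟩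
  sum1⊎ A′ B′ u′ v′ (map′ (splitAt (suc m) x)) (map′ (splitAt (suc m) y))
    ≡⟨ sym (sum1-join A′ B′ u′ v′ (map′ (splitAt (suc m) x)) (map′ (splitAt (suc m) y))) ⟩
  sum1 A′ B′ u′ v′ ((σ ⊕ remove v τ) ⟨$⟩ʳ x) ((σ ⊕ remove v τ) ⟨$⟩ʳ y) ∎
  where
  u′ = σ ⟨$⟩ʳ u
  v′ = τ ⟨$⟩ʳ v
  map′ = map (σ ⟨$⟩ʳ_) (remove v τ ⟨$⟩ʳ_)
  B-punchIn : ∀ a b → B (punchIn v a) b ≡ B′ (punchIn v′ (remove v τ ⟨$⟩ʳ a)) (τ ⟨$⟩ʳ b)
  B-punchIn a b = trans (rB _ b) (cong (λ z → B′ z (τ ⟨$⟩ʳ b)) (punchIn-permute τ v a))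
  on⊎ : ∀ s t → sum1⊎ A B u v s t ≡ sum1⊎ A′ B′ u′ v′ (map′ s) (map′ t)
  on⊎ (inj₁ a) (inj₁ b) = rA a b
  on⊎ (inj₂ a) (inj₂ b) = trans (B-punchIn a _) (cong (B′ _) (punchIn-permute τ v b))
  on⊎ (inj₁ a) (inj₂ b) with a ≟ u | σ ⟨$⟩ʳ a ≟ u′
  ... | yes _   | yes _      = trans (rB v _) (cong (B′ v′) (punchIn-permute τ v b))
  ... | yes a≡u | no σa≢σu   = contradiction (cong (σ ⟨$⟩ʳ_) a≡u) σa≢σu
  ... | no a≢u  | yes σa≡σu = contradiction (↔-injective σ σa≡σu) a≢u
  ... | no _    | no _       = refl
  on⊎ (inj₂ a) (inj₁ b) with b ≟ u | σ ⟨$⟩ʳ b ≟ u′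
  ... | yes _   | yes _      = B-punchIn a v
  ... | yes b≡u | no σb≢σu   = contradiction (cong (σ ⟨$⟩ʳ_) b≡u) σb≢σu
  ... | no b≢u  | yes σb≡σu = contradiction (↔-injective σ σb≡σu) b≢u
  ... | no _    | no _       = refl

canBeGenerated-compl : ∀ {A : Adj n} → CanBeGenerated A → CanBeGenerated (compl A)
canBeGenerated-compl (C , gen , σ , r) = compl C , gen-compl gen , σ , relabels-compl σ r

canBeGenerated-sum0 : ∀ {A : Adj m} {B : Adj n} → CanBeGenerated A → CanBeGenerated B → CanBeGenerated (sum0 A B)
canBeGenerated-sum0 (C , genC , σ , rA) (D , genD , τ , rB) =
  sum0 C D , gen-sum0 genC genD , σ ⊕ τ , relabels-sum0 σ τ rA rB

canBeGenerated-sum1 : ∀ {A : Adj (suc m)} {B : Adj (suc n)} u v →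
  CanBeGenerated A → CanBeGenerated B → CanBeGenerated (sum1 A B u v)
canBeGenerated-sum1 u v (C , genC , σ , rA) (D , genD , τ , rB) =
  sum1 C D (σ ⟨$⟩ʳ u) (τ ⟨$⟩ʳ v) , gen-sum1 genC genD _ _ , σ ⊕ remove v τ , relabels-sum1 σ τ u v rA rB

-- Components, separations and partitions

record Component (A : Adj n) (s : Fin n) : Set where
  field
    members   : Subset n
    source∈   : s ∈ members
    reachable : ∀ {x} → x ∈ members → Walk A s x
    closed    : Closed A (_∈ members)

component : (A : Adj n) (s : Fin n) → Component A s
component {n} A s = grow ⁅ s ⁆ (⊃-wellFounded _) (x∈⁅x⁆ s) from-source
  where
  from-source : ∀ {x} → x ∈ ⁅ s ⁆ → Walk A s x
  from-source x∈ with x∈⁅y⁆⇒x≡y s x∈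
  ... | refl = here
  -- Each step adds the end of an edge leaving R, so R strictly grows until it is closed.
  grow : (R : Subset n) → Acc _⊃_ R → s ∈ R → (∀ {x} → x ∈ R → Walk A s x) → Component A s
  grow R (acc larger) s∈R reach
    with any? (λ x → any? λ y → (x ∈? R) ×-dec ((A x y ≟ᵇ true) ×-dec ¬? (y ∈? R)))
  ... | no no-exit = record
    { members = R ; source∈ = s∈R ; reachable = reach
    ; closed  = λ x y x∈R edge → decidable-stable (y ∈? R) λ y∉R → no-exit (x , y , x∈R , edge , y∉R) }
  ... | yes (x , y , x∈R , edge , y∉R) =
    grow (⁅ y ⁆ ∪ R) (larger (q⊆p∪q ⁅ y ⁆ R , y , p⊆p∪q R (x∈⁅x⁆ y) , y∉R))
      (q⊆p∪q ⁅ y ⁆ R s∈R) reach′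
    where
    reach′ : ∀ {z} → z ∈ ⁅ y ⁆ ∪ R → Walk A s z
    reach′ z∈ with x∈p∪q⁻ ⁅ y ⁆ R z∈
    ... | inj₂ z∈R = reach z∈R
    ... | inj₁ z∈y with x∈⁅y⁆⇒x≡y y z∈y
    ...   | refl = reach x∈R ▷ edge

record Separation (A : Adj n) : Set where
  field
    side   : Subset n
    closed : Closed A (_∈ side)
    {inner outer} : Fin n
    inner∈ : inner ∈ side
    outer∉ : outer ∉ side

connected-or-separated : ∀ {A : Adj n} → Symmetric A → Fin n → Connected A ⊎ Separation A
connected-or-separated {n} {A} sym-A s = decide (all? (_∈? members))
  where
  open Component (component A s)
  decide : Dec (∀ x → x ∈ members) → Connected A ⊎ Separation A
  decide (yes all∈) = inj₁ λ i j → reverseʷ sym-A (reachable (all∈ i)) ++ʷ reachable (all∈ j)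
  decide (no ¬all∈) with ¬∀⟶∃¬ n _ (_∈? members) ¬all∈
  ... | t , t∉ = inj₂ record { side = members ; closed = closed ; inner∈ = source∈ ; outer∉ = t∉ }

Separable : Adj (suc n) → Set
Separable {n} A = Separation A ⊎ ∃ λ (v : Fin (suc n)) → Separation (delete A v)

twoConnected-or-separable : ∀ {A : Adj (3 + n)} → Symmetric A → TwoConnected A ⊎ Separable A
twoConnected-or-separable sym-A with connected-or-separated sym-A zero
... | inj₂ sep  = inj₂ (inj₁ sep)
... | inj₁ conn
  with all-or-exception (λ v → connected-or-separated (λ i j → sym-A (punchIn v i) (punchIn v j)) zero)
...   | inj₁ conn-del = inj₁ (s≤s (s≤s (s≤s z≤n)) , conn , conn-del)
...   | inj₂ cut      = inj₂ (inj₂ cut)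

record Partition (P : Fin n → Set) : Set where
  field
    {k₁ k₂} : ℕ
    ι       : (Fin k₁ ⊎ Fin k₂) ↔ Fin n
    inside  : ∀ a → P (Inverse.to ι (inj₁ a))
    outside : ∀ b → ¬ P (Inverse.to ι (inj₂ b))

  ι₁ : Fin k₁ → Fin n
  ι₁ = Inverse.to ι ∘ inj₁

  ι₂ : Fin k₂ → Fin n
  ι₂ = Inverse.to ι ∘ inj₂

  ι₁-injective : Injective _≡_ _≡_ ι₁
  ι₁-injective = inj₁-injective ∘ ↔-injective ι

  ι₂-injective : Injective _≡_ _≡_ ι₂
  ι₂-injective = inj₂-injective ∘ ↔-injective ι

  size : k₁ + k₂ ≡ n
  size = ↔⇒≡ (ι ↔-∘ +↔⊎)

  left-inhabited : ∀ {x} → P x → Fin k₁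
  left-inhabited {x} px with Inverse.from ι x in eq
  ... | inj₁ a = a
  ... | inj₂ b = contradiction (subst P (sym (Inverse.inverseˡ ι (sym eq))) px) (outside b)

  right-inhabited : ∀ {x} → ¬ P x → Fin k₂
  right-inhabited {x} ¬px with Inverse.from ι x in eq
  ... | inj₂ b = b
  ... | inj₁ a = contradiction (subst P (Inverse.inverseˡ ι (sym eq)) (inside a)) ¬px

private
  prepend-↔ : (Fin k ⊎ Fin m) ↔ Fin n → (Fin 1 ⊎ (Fin k ⊎ Fin m)) ↔ Fin (suc n)
  prepend-↔ ι = ↔-sym (+↔⊎ {1}) ↔-∘ ⊎-cong (↔-id _) ι

  zero-leftmost : (Fin (suc k) ⊎ Fin m) ↔ (Fin 1 ⊎ (Fin k ⊎ Fin m))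
  zero-leftmost = ⊎-assoc 0ℓ _ _ _ ↔-∘ ⊎-cong (+↔⊎ {1}) (↔-id _)

  zero-rightmost : (Fin k ⊎ Fin (suc m)) ↔ (Fin 1 ⊎ (Fin k ⊎ Fin m))
  zero-rightmost = ⊎-assoc 0ℓ _ _ _ ↔-∘
    (⊎-cong (⊎-comm _ _) (↔-id _) ↔-∘ (↔-sym (⊎-assoc 0ℓ _ _ _) ↔-∘ ⊎-cong (↔-id _) (+↔⊎ {1})))

partition : ∀ {P : Fin n → Set} → Decidable P → Partition P
partition {zero}  P? = record { ι = ↔-sym (+↔⊎ {0}) ; inside = λ () ; outside = λ () }
partition {suc n} P? with P? zero | partition (P? ∘ suc)
... | yes p₀ | record { ι = ι ; inside = inside ; outside = outside } = record
  { ι       = prepend-↔ ι ↔-∘ zero-leftmost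
  ; inside  = λ { zero → p₀ ; (suc a) → inside a }
  ; outside = outside }
... | no ¬p₀ | record { ι = ι ; inside = inside ; outside = outside } = record
  { ι       = prepend-↔ ι ↔-∘ zero-rightmost
  ; inside  = inside
  ; outside = λ { zero → ¬p₀ ; (suc b) → outside b } }

module SidePartition {A : Adj n} (sep : Separation A) where
  open Separation sep public

  side-partition : Partition (_∈ side)
  side-partition = partition (_∈? side)

  open Partition side-partition public

  inner-index : Fin k₁
  inner-index = left-inhabited inner∈

  outer-index : Fin k₂
  outer-index = right-inhabited outer∉

-- 2-cographs are generated

module _ {A : Adj n} (sym-A : Symmetric A) {P : Fin n → Set} (closed : Closed A P) (π : Partition P) where
  open Partition π

  sum0-of-parts : Relabels (sum0 (induce A ι₁) (induce A ι₂)) (ι ↔-∘ +↔⊎) A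
  sum0-of-parts x y = trans (sum0-splitAt (induce A ι₁) (induce A ι₂) x y) (on⊎ (splitAt k₁ x) (splitAt k₁ y))
    where
    on⊎ : ∀ s t → sum0⊎ (induce A ι₁) (induce A ι₂) s t ≡ A (Inverse.to ι s) (Inverse.to ι t)
    on⊎ (inj₁ a) (inj₁ b) = refl
    on⊎ (inj₂ a) (inj₂ b) = refl
    on⊎ (inj₁ a) (inj₂ b) = sym (no-edge-leaving closed (inside a) (outside b))
    on⊎ (inj₂ a) (inj₁ b) = sym (trans (sym-A _ _) (no-edge-leaving closed (inside b) (outside a)))

module _ {A : Adj (suc n)} (sym-A : Symmetric A) (v : Fin (suc n)) {P : Fin n → Set}
         (closed : Closed (delete A v) P) (π : Partition P) where
  open Partition π

  sum1-of-parts : Relabels (sum1 (induce A (extend v ι₁)) (induce A (extend v ι₂)) zero zero)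
                            (insert zero v (ι ↔-∘ +↔⊎)) A
  sum1-of-parts x y = begin
    sum1 A₁ A₂ zero zero x y
      ≡⟨ sum1-splitAt A₁ A₂ zero zero x y ⟩
    sum1⊎ A₁ A₂ zero zero (splitAt (suc k₁) x) (splitAt (suc k₁) y)
      ≡⟨ on⊎ (splitAt (suc k₁) x) (splitAt (suc k₁) y) ⟩
    A (glue (splitAt (suc k₁) x)) (glue (splitAt (suc k₁) y))
      ≡⟨ sym (cong₂ A (glue-splitAt x) (glue-splitAt y)) ⟩
    A (insert zero v (ι ↔-∘ +↔⊎) ⟨$⟩ʳ x) (insert zero v (ι ↔-∘ +↔⊎) ⟨$⟩ʳ y) ∎
    where
    A₁ = induce A (extend v ι₁)
    A₂ = induce A (extend v ι₂)
    glue : Fin (suc k₁) ⊎ Fin k₂ → Fin (suc n)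
    glue = [ extend v ι₁ , punchIn v ∘ ι₂ ]′
    glue-splitAt : ∀ x → insert zero v (ι ↔-∘ +↔⊎) ⟨$⟩ʳ x ≡ glue (splitAt (suc k₁) x)
    glue-splitAt zero = refl
    glue-splitAt (suc x) with splitAt k₁ x
    ... | inj₁ a = refl
    ... | inj₂ b = refl
    on⊎ : ∀ s t → sum1⊎ A₁ A₂ zero zero s t ≡ A (glue s) (glue t)
    on⊎ (inj₁ a)       (inj₁ b)       = refl
    on⊎ (inj₂ a)       (inj₂ b)       = refl
    on⊎ (inj₁ zero)    (inj₂ b)       = refl
    on⊎ (inj₂ a)       (inj₁ zero)    = refl
    on⊎ (inj₁ (suc a)) (inj₂ b)       = sym (no-edge-leaving closed (inside a) (outside b))
    on⊎ (inj₂ a)       (inj₁ (suc b)) = sym (trans (sym-A _ _) (no-edge-leaving closed (inside b) (outside a)))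

TwoCographsGenerated : ℕ → Set
TwoCographsGenerated n = (G : Adj (suc n)) → IsSimple G → TwoCograph G → CanBeGenerated G

module _ (rec : ∀ {m} → m < n → TwoCographsGenerated m)
         {G : Adj (suc n)} (simple : IsSimple G) (tG : TwoCograph G) where

  private
    induced-generated : ∀ {k} (f : Fin k → Fin (suc n)) → Injective _≡_ _≡_ f → k ≤ n → Fin k →
      CanBeGenerated (induce G f)
    induced-generated {suc k} f f-inj k<n _ =
      rec k<n (induce G f) (isSimple-induce simple f) (twoCograph-embed {A = G} tG f-inj λ _ _ _ → refl)

    left-summand-< : ∀ {k l m} → Fin l → k + l ≡ m → k < m
    left-summand-< {k} {suc l} _ refl = m<m+n k (s≤s z≤n)

    right-summand-< : ∀ {k l m} → Fin k → k + l ≡ m → l < m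
    right-summand-< {suc k} {l} _ refl = m<n+m l (s≤s z≤n)

  generated-if-separable : Separable G → CanBeGenerated G
  generated-if-separable (inj₁ sep) =
    canBeGenerated-relabel (ι ↔-∘ +↔⊎) (sum0-of-parts (proj₁ simple) closed side-partition)
      (canBeGenerated-sum0
        (induced-generated ι₁ ι₁-injective (≤-pred (left-summand-< outer-index size)) inner-index)
        (induced-generated ι₂ ι₂-injective (≤-pred (right-summand-< inner-index size)) outer-index))
    where open SidePartition sep
  generated-if-separable (inj₂ (v , sep)) =
    canBeGenerated-relabel (insert zero v (ι ↔-∘ +↔⊎)) (sum1-of-parts (proj₁ simple) v closed side-partition)
      (canBeGenerated-sum1 zero zero
        (induced-generated (extend v ι₁) (extend-injective v ι₁-injective) (left-summand-< outer-index size) zero)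
        (induced-generated (extend v ι₂) (extend-injective v ι₂-injective) (right-summand-< inner-index size) zero))
    where open SidePartition sep

adj₂-relabel : ∀ {A B : Adj 2} → IsSimple A → B zero zero ≡ false → B (suc zero) (suc zero) ≡ false →
  B (suc zero) zero ≡ B zero (suc zero) → A zero (suc zero) ≡ B zero (suc zero) → Relabels A idₚ B
adj₂-relabel (_     , irr-A) B₀₀ _   _     _   zero       zero       = trans (irr-A zero) (sym B₀₀)
adj₂-relabel (_     , _)     _   _   _     A₀₁ zero       (suc zero) = A₀₁
adj₂-relabel (sym-A , _)     _   _   B-sym A₀₁ (suc zero) zero       = trans (sym-A _ _) (trans A₀₁ (sym B-sym))
adj₂-relabel (_     , irr-A) _   B₁₁ _     _   (suc zero) (suc zero) = trans (irr-A (suc zero)) (sym B₁₁)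

-- On two vertices neither G nor its complement is 2-connected; G is K1 + K1 or its complement.
two-vertices-generated : (G : Adj 2) → IsSimple G → CanBeGenerated G
two-vertices-generated G simple with G zero (suc zero) in G₀₁
... | false = sum0 K1 K1 , gen-sum0 gen-K1 gen-K1 , idₚ , adj₂-relabel simple refl refl refl G₀₁
... | true  = compl (sum0 K1 K1) , gen-compl (gen-sum0 gen-K1 gen-K1) , idₚ , adj₂-relabel simple refl refl refl G₀₁

twoCographs-generated : ∀ n → TwoCographsGenerated n
twoCographs-generated = <-rec TwoCographsGenerated generated-from-smaller
  where
  generated-from-smaller : ∀ n → (∀ {m} → m < n → TwoCographsGenerated m) → TwoCographsGenerated n
  generated-from-smaller zero          _   G (_ , irr-G) _ = K1 , gen-K1 , idₚ , λ { zero zero → irr-G zero }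
  generated-from-smaller (suc zero)    _   G simple      _ = two-vertices-generated G simple
  generated-from-smaller (suc (suc n)) rec G simple tG
    with twoConnected-or-separable (proj₁ simple) | twoConnected-or-separable (proj₁ (isSimple-compl simple))
  ... | inj₂ sep | _        = generated-if-separable rec simple tG sep
  ... | inj₁ _   | inj₂ sep = canBeGenerated-relabel idₚ (compl-involutive simple)
      (canBeGenerated-compl (generated-if-separable rec (isSimple-compl simple) (twoCograph-compl tG) sep))
  ... | inj₁ t   | inj₁ t′  = contradiction (t , t′) (not-both-twoConnected tG)

lemma2p6 : ∀ (n : ℕ) (G : Adj (suc n)) → IsSimple G →
    (TwoCograph G ⇔ CanBeGenerated G)
lemma2p6 n G simple = mk⇔ (twoCographs-generated n G simple) canBeGenerated-twoCograph
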